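{- Let $m\ge 4$ and let $n\ge 5$ be odd. Let $G(**)$ be the subgraph of $G_{m,n}=S_m\Box P_n$ induced by $V(S_m)\times\{i: 2\le i\le n-1,\ i\ne \tfrac{n+1}{2}\}$. Then the radio number of $G(**)$ in $G_{m,n}$ satisfies $$rn(G(**))\le \tfrac{1}{2}\left(mn^2-2mn+2n-3m-12\right).$$
   Context: $S_m$ is the star on $m$ vertices with center $c$ and leaves; $P_n$ is the path with vertices $1,\dots,n$. $G_{m,n}=S_m\Box P_n$ has vertex set $V(S_m)\times\{1,\dots,n\}$, with $(a,i)\sim(b,j)$ iff ($a=b$ and $|i-j|=1$) or ($i=j$ and $ab\in E(S_m)$). Its distance is $d((a,i),(b,j))=d_{S_m}(a,b)+|i-j|$ and its diameter is $n+1$. For a subset $H$ of vertices (or induced subgraph) of $G_{m,n}$, a radio labeling of $H$ in $G_{m,n}$ is a function $f:V(H)\to\mathbb{Z}_{\ge 0}$ with $|f(u)-f(v)|\ge \mathrm{diam}(G_{m,n})+1-d_{G_{m,n}}(u,v)$ for all distinct $u,v\in V(H)$ (distances and diameter taken in $G_{m,n}$); its span is $\max f-\min f$, and $rn(H)$ is the minimum span over all such labelings. -}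

module Defs where

open import Data.Nat using (ℕ; zero; suc; _+_; _*_; _∸_; _≤_; _/_; ∣_-_∣)
open import Data.Fin using (Fin; toℕ)
import Data.Fin as F
open import Data.Product using (_×_)
open import Relation.Binary.PropositionalEquality using (_≡_; _≢_)
open import Relation.Nullary using (¬_; yes; no)

-- Star S_m on vertex set Fin m; the center c is the vertex with toℕ c ≡ 0,
-- all other vertices are leaves.  Distance in S_m:
starDist : {m : ℕ} → Fin m → Fin m → ℕ
starDist a b with a F.≟ b
... | yes _ = 0
... | no _ with toℕ a | toℕ b
...   | zero  | _     = 1
...   | suc _ | zero  = 1
...   | suc _ | suc _ = 2

gDist : {m : ℕ} → Fin m → ℕ → Fin m → ℕ → ℕ
gDist a i b j = starDist a b + ∣ i - j ∣

diamG : ℕ → ℕ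
diamG n = n + 1

InLayers : ℕ → ℕ → Set
InLayers n i = (2 ≤ i) × (i ≤ n ∸ 1) × (i ≢ (n + 1) / 2)

-- f is a radio labeling of G(**) in G_{m,n}:
-- |f(u) - f(v)| ≥ diam + 1 - d(u,v) for distinct u, v in G(**)
-- (stated additively; equivalent since everything is in ℕ).
IsRadioLabeling : (m n : ℕ) → (Fin m → ℕ → ℕ) → Set
IsRadioLabeling m n f =
  ∀ (a b : Fin m) (i j : ℕ) → InLayers n i → InLayers n j →
  ¬ (a ≡ b × i ≡ j) →
  diamG n + 1 ≤ gDist a i b j + ∣ f a i - f b j ∣

-- The span of f on G(**) is at most B: max f - min f ≤ B,
-- i.e. f(u) ≤ f(v) + B for all u, v in G(**).
SpanAtMost : (m n : ℕ) → (Fin m → ℕ → ℕ) → ℕ → Set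
SpanAtMost m n f B =
  ∀ (a b : Fin m) (i j : ℕ) → InLayers n i → InLayers n j →
  f a i ≤ f b j + B

RadioNumberAtMost : (m n : ℕ) → ℕ → Set
RadioNumberAtMost m n B =
  Data.Product.Σ (Fin m → ℕ → ℕ) (λ f → IsRadioLabeling m n f × SpanAtMost m n f B)

{-# OPTIONS --safe #-}
-- Write n = 2k + 1. List the vertices of G(**) block by block: block b consists of the layers
-- k − b and 2k − b, which are at path distance k, and inside a block lower and upper vertices
-- alternate, the lower ones in star order and the upper ones permuted by upperIndex. Then
-- consecutive vertices lie over distinct star vertices, both leaves unless one is the center.
-- Give the p-th vertex the label (k + 1) p plus a bonus that grows by one exactly at the
-- consecutive pairs at distance only k + 1: the two pairs through the center in each block
-- and the passages between blocks. Consecutive vertices then satisfy the radio condition,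
-- vertices further apart have labels at least 2k + 2 = diam apart, and the largest label is
-- the bound.
module Submission where

open import Defs
open import Data.Nat using (ℕ; _+_; _*_; _∸_; _≤_; _/_; _%_)
open import Relation.Binary.PropositionalEquality using (_≡_)

open import Data.Nat using (zero; suc; _<_; _≤?_; z≤n; s≤s; ∣_-_∣)
open import Data.Nat.Properties
open import Data.Nat.DivMod using (m≡m%n+[m/n]*n; m*n/n≡m; [m+kn]%n≡m%n; m≤n⇒m%n≡m; %-congˡ)
open import Data.Nat.Tactic.RingSolver using (solve-∀)
open import Data.Fin using (Fin; toℕ)
import Data.Fin as F
open import Data.Fin.Properties using (toℕ<n; toℕ-injective)
open import Data.Product using (_×_; _,_; proj₁; proj₂; map; ∃-syntax)
open import Data.Product.Properties using (,-injectiveˡ; ,-injectiveʳ)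
open import Data.Sum using (_⊎_; inj₁; inj₂)
open import Data.Empty using (⊥-elim)
open import Function using (_∘_)
open import Relation.Binary using (tri<; tri≈; tri>)
open import Relation.Binary.PropositionalEquality
  using (refl; sym; trans; cong; cong₂; subst; subst₂; _≢_; module ≡-Reasoning)
open import Relation.Nullary using (¬_; yes; no)

m+n≤o+p⇒m≤o+∣n-p∣ : ∀ {m n o p} → m + n ≤ o + p → m ≤ o + ∣ n - p ∣
m+n≤o+p⇒m≤o+∣n-p∣ {m} {n} {o} {p} le with ≤-total n p
... | inj₁ n≤p = begin
  m             ≤⟨ m+n≤o⇒m≤o∸n m le ⟩
  o + p ∸ n     ≡⟨ +-∸-assoc o n≤p ⟩
  o + (p ∸ n)   ≡⟨ cong (o +_) (sym (m≤n⇒∣m-n∣≡n∸m n≤p)) ⟩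
  o + ∣ n - p ∣ ∎
  where open ≤-Reasoning
... | inj₂ p≤n = ≤-trans (+-cancelʳ-≤ n m o (≤-trans le (+-monoʳ-≤ o p≤n))) (m≤m+n o _)

∸≡∸⇒∣-∣ : ∀ {a l i j} → i ≤ a → j ≤ l + a → a ∸ i ≡ l + a ∸ j → ∣ i - j ∣ ≡ l
∸≡∸⇒∣-∣ {a} {l} {i} {j} i≤a j≤l+a eq = trans (cong (∣ i -_∣) j≡i+l) (∣m-m+n∣≡n i l)
  where
  open ≡-Reasoning
  j≡i+l : j ≡ i + l
  j≡i+l = +-cancelˡ-≡ (a ∸ i) j (i + l) (begin
    a ∸ i + j         ≡⟨ cong (_+ j) eq ⟩
    l + a ∸ j + j     ≡⟨ m∸n+n≡m j≤l+a ⟩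
    l + a             ≡⟨ cong (l +_) (sym (m∸n+n≡m i≤a)) ⟩
    l + (a ∸ i + i)   ≡⟨ rearrange l (a ∸ i) i ⟩
    a ∸ i + (i + l)   ∎)
    where
    rearrange : ∀ l x i → l + (x + i) ≡ x + (i + l)
    rearrange = solve-∀

module _ {V : Set} (In : V → Set) (d : V → V → ℕ) (T : ℕ) (pos f : V → ℕ)
         (d-sym : ∀ u v → d u v ≡ d v u)
         (d-pos : ∀ {u v} → u ≢ v → 1 ≤ d u v)
         (pos-injective : ∀ {u v} → In u → In v → pos u ≡ pos v → u ≡ v)
         (far-gap : ∀ {u v} → 2 + pos u ≤ pos v → T + f u ≤ suc (f v))
         (near-gap : ∀ {u v} → In u → In v → suc (pos u) ≡ pos v → T + f u ≤ d u v + f v)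
         where

  ordered-gap : ∀ {u v} → In u → In v → u ≢ v → pos u < pos v → T + f u ≤ d u v + f v
  ordered-gap {u} {v} iu iv u≢v lt with suc (pos u) ≟ pos v
  ... | yes next = near-gap iu iv next
  ... | no ¬next = ≤-trans (far-gap (≤∧≢⇒< lt ¬next)) (+-monoˡ-≤ (f v) (d-pos u≢v))

  radio-by-order : ∀ {u v} → In u → In v → u ≢ v → T ≤ d u v + ∣ f u - f v ∣
  radio-by-order {u} {v} iu iv u≢v with <-cmp (pos u) (pos v)
  ... | tri< lt _ _ = m+n≤o+p⇒m≤o+∣n-p∣ (ordered-gap iu iv u≢v lt)
  ... | tri≈ _ eq _ = ⊥-elim (u≢v (pos-injective iu iv eq))
  ... | tri> _ _ gt = subst₂ (λ x y → T ≤ x + y) (d-sym v u) (∣-∣-comm (f v) (f u))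
                        (m+n≤o+p⇒m≤o+∣n-p∣ (ordered-gap iv iu (u≢v ∘ sym) gt))

digits-injective : ∀ w {b b' r r'} → r ≤ w → r' ≤ w →
                   b * suc w + r ≡ b' * suc w + r' → b ≡ b' × r ≡ r'
digits-injective w {b} {b'} {r} {r'} r≤w r'≤w eq = b≡b' , r≡r'
  where
  remainder : ∀ {q s} → s ≤ w → (q * suc w + s) % suc w ≡ s
  remainder {q} {s} s≤w = begin
    (q * suc w + s) % suc w ≡⟨ %-congˡ (+-comm (q * suc w) s) ⟩
    (s + q * suc w) % suc w ≡⟨ [m+kn]%n≡m%n s q (suc w) ⟩
    s % suc w               ≡⟨ m≤n⇒m%n≡m s≤w ⟩
    s                       ∎
    where open ≡-Reasoning
  r≡r' : r ≡ r'
  r≡r' = trans (sym (remainder {b} r≤w)) (trans (%-congˡ eq) (remainder {b'} r'≤w))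
  b≡b' : b ≡ b'
  b≡b' = *-cancelʳ-≡ b b' (suc w)
           (+-cancelʳ-≡ r (b * suc w) (b' * suc w) (trans eq (cong (b' * suc w +_) (sym r≡r'))))

digits-< : ∀ w {b b' r r'} → r ≤ w → r' ≤ w →
           b * suc w + r < b' * suc w + r' → b < b' ⊎ (b ≡ b' × r < r')
digits-< w {b} {b'} {r} {r'} r≤w r'≤w lt with <-cmp b b'
... | tri< b<b' _ _ = inj₁ b<b'
... | tri≈ _ refl _ = inj₂ (refl , +-cancelˡ-< (b * suc w) r r' lt)
... | tri> _ _ b'<b = ⊥-elim (<-asym lt (begin-strict
  b' * suc w + r'    <⟨ +-monoʳ-< (b' * suc w) (s≤s r'≤w) ⟩
  b' * suc w + suc w ≡⟨ +-comm (b' * suc w) (suc w) ⟩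
  suc b' * suc w     ≤⟨ *-monoˡ-≤ (suc w) b'<b ⟩
  b * suc w          ≤⟨ m≤m+n (b * suc w) r ⟩
  b * suc w + r      ∎))
  where open ≤-Reasoning

digits-suc : ∀ w {b b' r r'} → r ≤ w → r' ≤ w → suc (b * suc w + r) ≡ b' * suc w + r' →
             (b' ≡ b × r' ≡ suc r) ⊎ (b' ≡ suc b × r ≡ w × r' ≡ 0)
digits-suc w {b} {b'} {r} r≤w r'≤w eq with m≤n⇒m<n∨m≡n r≤w
... | inj₁ r<w = inj₁ (map sym sym (digits-injective w r<w r'≤w (trans (+-suc (b * suc w) r) eq)))
... | inj₂ refl =
  let b≡b' , r≡r' = digits-injective w z≤n r'≤w (trans (carry b w) eq)
  in  inj₂ (sym b≡b' , refl , sym r≡r')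
  where
  carry : ∀ b w → suc b * suc w + 0 ≡ suc (b * suc w + w)
  carry = solve-∀

slot-≤ : ∀ {w t s} → t ≤ w → s ≤ 1 → t * 2 + s ≤ w * 2 + 1
slot-≤ t≤w s≤1 = +-mono-≤ (*-monoˡ-≤ 2 t≤w) s≤1

places-injective : ∀ w b b' {t t' s s'} → t ≤ w → t' ≤ w → s ≤ 1 → s' ≤ 1 →
                   b * suc (w * 2 + 1) + (t * 2 + s) ≡ b' * suc (w * 2 + 1) + (t' * 2 + s') →
                   b ≡ b' × t ≡ t' × s ≡ s'
places-injective w _ _ t≤w t'≤w s≤1 s'≤1 eq
  with digits-injective (w * 2 + 1) (slot-≤ t≤w s≤1) (slot-≤ t'≤w s'≤1) eq
... | b≡b' , same-slot with digits-injective 1 s≤1 s'≤1 same-slot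
...   | t≡t' , s≡s' = b≡b' , t≡t' , s≡s'

successor-places : ∀ w b b' {t t' s s'} → t ≤ w → t' ≤ w → s ≤ 1 → s' ≤ 1 →
  suc (b * suc (w * 2 + 1) + (t * 2 + s)) ≡ b' * suc (w * 2 + 1) + (t' * 2 + s') →
  (b' ≡ b × t' ≡ t × s ≡ 0 × s' ≡ 1) ⊎
  (b' ≡ b × t' ≡ suc t × s ≡ 1 × s' ≡ 0) ⊎
  (b' ≡ suc b × s ≡ 1 × s' ≡ 0)
successor-places w _ _ t≤w t'≤w s≤1 s'≤1 eq
  with digits-suc (w * 2 + 1) (slot-≤ t≤w s≤1) (slot-≤ t'≤w s'≤1) eq
... | inj₁ (b'≡b , next-slot) with digits-suc 1 s≤1 s'≤1 (sym next-slot)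
successor-places w _ _ _ _ _ (s≤s z≤n) _ | inj₁ (b'≡b , _) | inj₁ (t'≡t , refl) =
  inj₁ (b'≡b , t'≡t , refl , refl)
...   | inj₂ (t'≡1+t , s≡1 , s'≡0) = inj₂ (inj₁ (b'≡b , t'≡1+t , s≡1 , s'≡0))
successor-places w _ _ {t} {t'} t≤w t'≤w s≤1 s'≤1 eq | inj₂ (b'≡1+b , last-slot , first-slot) =
  inj₂ (inj₂ (b'≡1+b , proj₂ (digits-injective 1 {t} {w} s≤1 ≤-refl last-slot) ,
                      proj₂ (digits-injective 1 {t'} {0} s'≤1 z≤n first-slot)))

atLeast : ℕ → ℕ → ℕ
atLeast zero    r       = 1
atLeast (suc c) zero    = 0
atLeast (suc c) (suc r) = atLeast c r

atLeast-mono : ∀ c {r r'} → r ≤ r' → atLeast c r ≤ atLeast c r'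
atLeast-mono zero    r≤r'      = ≤-refl
atLeast-mono (suc c) z≤n       = z≤n
atLeast-mono (suc c) (s≤s r≤r') = atLeast-mono c r≤r'

atLeast-≤1 : ∀ c r → atLeast c r ≤ 1
atLeast-≤1 zero    r       = ≤-refl
atLeast-≤1 (suc c) zero    = z≤n
atLeast-≤1 (suc c) (suc r) = atLeast-≤1 c r

atLeast-≤ : ∀ {c r} → c ≤ r → atLeast c r ≡ 1
atLeast-≤ z≤n       = refl
atLeast-≤ (s≤s c≤r) = atLeast-≤ c≤r

atLeast-< : ∀ {c r} → r < c → atLeast c r ≡ 0
atLeast-< {suc c} {zero}  _         = refl
atLeast-< {suc c} {suc r} (s≤s r<c) = atLeast-< r<c

starDist-sym : ∀ {m} (a b : Fin m) → starDist a b ≡ starDist b a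
starDist-sym a b with a F.≟ b | b F.≟ a
... | yes _   | yes _   = refl
... | yes a≡b | no b≢a  = ⊥-elim (b≢a (sym a≡b))
... | no a≢b  | yes b≡a = ⊥-elim (a≢b (sym b≡a))
... | no _    | no _ with toℕ a | toℕ b
...   | zero  | zero  = refl
...   | zero  | suc _ = refl
...   | suc _ | zero  = refl
...   | suc _ | suc _ = refl

starDist-pos : ∀ {m} {a b : Fin m} → a ≢ b → 1 ≤ starDist a b
starDist-pos {a = a} {b} a≢b with a F.≟ b
... | yes a≡b = ⊥-elim (a≢b a≡b)
... | no _ with toℕ a | toℕ b
...   | zero  | _     = s≤s z≤n
...   | suc _ | zero  = s≤s z≤n
...   | suc _ | suc _ = s≤s z≤n

starDist-leaves : ∀ {m} {a b : Fin m} → a ≢ b → toℕ a ≢ 0 → toℕ b ≢ 0 → 2 ≤ starDist a b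
starDist-leaves {a = a} {b} a≢b a-leaf b-leaf with a F.≟ b
... | yes a≡b = ⊥-elim (a≢b a≡b)
... | no _ with toℕ a | toℕ b
...   | zero  | _     = ⊥-elim (a-leaf refl)
...   | suc _ | zero  = ⊥-elim (b-leaf refl)
...   | suc _ | suc _ = s≤s (s≤s z≤n)

gDist-sym : ∀ {m} (a : Fin m) i b j → gDist a i b j ≡ gDist b j a i
gDist-sym a i b j = cong₂ _+_ (starDist-sym a b) (∣-∣-comm i j)

gDist-pos : ∀ {m} {a b : Fin m} {i j} → (a , i) ≢ (b , j) → 1 ≤ gDist a i b j
gDist-pos {a = a} {b} {i} {j} ne with toℕ a ≟ toℕ b
... | no a≢b = ≤-trans (starDist-pos (a≢b ∘ cong toℕ)) (m≤m+n _ _)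
... | yes a≡b = ≤-trans (n≢0⇒n>0 (ne ∘ cong₂ _,_ (toℕ-injective a≡b) ∘ ∣m-n∣≡0⇒m≡n)) (m≤n+m _ _)

module Construction (M K : ℕ) where

  m k n w last T : ℕ
  m = 4 + M
  k = 2 + K
  n = 1 + k * 2
  w = 3 + M
  last = w * 2 + 1
  T = diamG n + 1

  -- The digit of the upper copy of star vertex t: a derangement with the center last, and never
  -- one less than t, so that an upper vertex and the next lower one are distinct leaves.
  upperIndex : ℕ → ℕ
  upperIndex zero          = w
  upperIndex (suc zero)    = 2 + M
  upperIndex (suc (suc t)) = t

  upperIndex-≤ : ∀ {t} → t ≤ w → upperIndex t ≤ w
  upperIndex-≤ {zero}        _   = ≤-refl
  upperIndex-≤ {suc zero}    _   = n≤1+n _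
  upperIndex-≤ {suc (suc t)} t≤w = ≤-trans (n≤1+n t) (≤-trans (n≤1+n (suc t)) t≤w)

  upperIndex-injective : ∀ {t t'} → t ≤ w → t' ≤ w → upperIndex t ≡ upperIndex t' → t ≡ t'
  upperIndex-injective {zero}        {zero}         _ _ _ = refl
  upperIndex-injective {zero}        {suc zero}     _ _ eq = ⊥-elim (1+n≢n eq)
  upperIndex-injective {zero}        {suc (suc t')} _ (s≤s (s≤s t'≤)) eq =
    ⊥-elim (<⇒≢ (m≤n⇒m≤1+n (s≤s t'≤)) (sym eq))
  upperIndex-injective {suc zero}    {zero}         _ _ eq = ⊥-elim (1+n≢n (sym eq))
  upperIndex-injective {suc zero}    {suc zero}     _ _ _ = refl
  upperIndex-injective {suc zero}    {suc (suc t')} _ (s≤s (s≤s t'≤)) eq =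
    ⊥-elim (<⇒≢ (s≤s t'≤) (sym eq))
  upperIndex-injective {suc (suc t)} {zero}         (s≤s (s≤s t≤)) _ eq =
    ⊥-elim (<⇒≢ (m≤n⇒m≤1+n (s≤s t≤)) eq)
  upperIndex-injective {suc (suc t)} {suc zero}     (s≤s (s≤s t≤)) _ eq =
    ⊥-elim (<⇒≢ (s≤s t≤) eq)
  upperIndex-injective {suc (suc t)} {suc (suc t')} _ _ eq = cong (suc ∘ suc) eq

  upperIndex-≢ : ∀ t → upperIndex t ≢ t
  upperIndex-≢ zero          = λ ()
  upperIndex-≢ (suc zero)    = λ ()
  upperIndex-≢ (suc (suc t)) = λ ()

  suc-upperIndex-≢ : ∀ t → suc (upperIndex t) ≢ t
  suc-upperIndex-≢ zero          = λ ()
  suc-upperIndex-≢ (suc zero)    = λ ()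
  suc-upperIndex-≢ (suc (suc t)) = λ ()

  middle-layer : (n + 1) / 2 ≡ suc k
  middle-layer = trans (cong (_/ 2) (double k)) (m*n/n≡m (suc k) 2)
    where
    double : ∀ k → 1 + k * 2 + 1 ≡ suc k * 2
    double = solve-∀

  upper-layer : ∀ {i} → InLayers n i → ¬ i ≤ k → 2 + k ≤ i × i ≤ k + k
  upper-layer {i} (_ , i≤2k , i≢middle) i≰k =
    ≤∧≢⇒< (≰⇒> i≰k) (λ eq → i≢middle (trans (sym eq) (sym middle-layer))) ,
    subst (i ≤_) (twice k) i≤2k
    where
    twice : ∀ k → k * 2 ≡ k + k
    twice = solve-∀

  -- A vertex sits in slot digit * 2 + side of its block; side 0 is the lower half (layers 2 … k),
  -- side 1 the upper half (layers k + 2 … 2k).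
  record Place : Set where
    constructor ⟨_,_,_⟩
    field
      block digit side : ℕ
  open Place

  lowerPlace upperPlace place : Fin m → ℕ → Place
  lowerPlace a i = ⟨ k ∸ i , toℕ a , 0 ⟩
  upperPlace a i = ⟨ k + k ∸ i , upperIndex (toℕ a) , 1 ⟩
  place a i with i ≤? k
  ... | yes _ = lowerPlace a i
  ... | no _  = upperPlace a i

  slotBonus : ℕ → ℕ
  slotBonus r = atLeast 1 r + atLeast last r

  -- Each block earns three units of bonus: its two center pairs and the passage to the next block.
  slot position bonus labelAt : Place → ℕ
  slot p     = digit p * 2 + side p
  position p = block p * suc last + slot p
  bonus p    = 3 * block p + slotBonus (slot p)
  labelAt p  = suc k * position p + bonus p

  label : Fin m → ℕ → ℕ
  label a i = labelAt (place a i)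

  toℕ≤w : (a : Fin m) → toℕ a ≤ w
  toℕ≤w a = ≤-pred (toℕ<n a)

  slot-≤-last : ∀ a i → slot (place a i) ≤ last
  slot-≤-last a i with i ≤? k
  ... | yes _ = slot-≤ (toℕ≤w a) z≤n
  ... | no _  = slot-≤ (upperIndex-≤ (toℕ≤w a)) ≤-refl

  block-≤ : ∀ a {i} → InLayers n i → block (place a i) ≤ K
  block-≤ a {i} vi with i ≤? k
  ... | yes _  = ∸-monoʳ-≤ k (proj₁ vi)
  ... | no i≰k =
    ≤-trans (∸-monoʳ-≤ (k + k) (proj₁ (upper-layer vi i≰k))) (≤-reflexive (m+n∸n≡m K k))

  position-injective : ∀ {a a' i j} → InLayers n i → InLayers n j →
                       position (place a i) ≡ position (place a' j) → (a , i) ≡ (a' , j)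
  position-injective {a} {a'} {i} {j} vi vj eq with i ≤? k | j ≤? k
  ... | yes i≤k | yes j≤k
    with places-injective w (k ∸ i) (k ∸ j) (toℕ≤w a) (toℕ≤w a') z≤n z≤n eq
  ...   | blocks , digits , _ = cong₂ _,_ (toℕ-injective digits) (∸-cancelˡ-≡ i≤k j≤k blocks)
  position-injective {a} {a'} {i} {j} vi vj eq | yes _ | no _
    with places-injective w (k ∸ i) (k + k ∸ j) (toℕ≤w a) (upperIndex-≤ (toℕ≤w a')) z≤n ≤-refl eq
  ...   | _ , _ , ()
  position-injective {a} {a'} {i} {j} vi vj eq | no _ | yes _
    with places-injective w (k + k ∸ i) (k ∸ j) (upperIndex-≤ (toℕ≤w a)) (toℕ≤w a') ≤-refl z≤n eq
  ...   | _ , _ , ()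
  position-injective {a} {a'} {i} {j} vi vj eq | no i≰k | no j≰k
    with places-injective w (k + k ∸ i) (k + k ∸ j) (upperIndex-≤ (toℕ≤w a)) (upperIndex-≤ (toℕ≤w a'))
                          ≤-refl ≤-refl eq
  ...   | blocks , digits , _ =
    cong₂ _,_ (toℕ-injective (upperIndex-injective (toℕ≤w a) (toℕ≤w a') digits))
              (∸-cancelˡ-≡ (proj₂ (upper-layer vi i≰k)) (proj₂ (upper-layer vj j≰k)) blocks)

  slotBonus-mono : ∀ {r r'} → r ≤ r' → slotBonus r ≤ slotBonus r'
  slotBonus-mono r≤r' = +-mono-≤ (atLeast-mono 1 r≤r') (atLeast-mono last r≤r')

  slotBonus-≤2 : ∀ r → slotBonus r ≤ 2
  slotBonus-≤2 r = +-mono-≤ (atLeast-≤1 1 r) (atLeast-≤1 last r)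

  slotBonus-<last : ∀ {r} → r < last → slotBonus r ≤ 1
  slotBonus-<last {r} r<last = begin
    atLeast 1 r + atLeast last r ≡⟨ cong (atLeast 1 r +_) (atLeast-< r<last) ⟩
    atLeast 1 r + 0              ≡⟨ +-identityʳ _ ⟩
    atLeast 1 r                  ≤⟨ atLeast-≤1 1 r ⟩
    1                            ∎
    where open ≤-Reasoning

  slotBonus-last : slotBonus last ≡ 2
  slotBonus-last = cong suc (atLeast-≤ {last} ≤-refl)

  lower-slot-<last : ∀ {t} → t ≤ w → t * 2 + 0 < last
  lower-slot-<last t≤w = +-mono-≤-< (*-monoˡ-≤ 2 t≤w) (s≤s z≤n)

  upper-slot-<last : ∀ {t} → t < w → t * 2 + 1 < last
  upper-slot-<last t<w = +-mono-<-≤ (*-monoˡ-< 2 t<w) ≤-refl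

  bonus-mono : ∀ {p q} → slot p ≤ last → slot q ≤ last → position p < position q → bonus p ≤ bonus q
  bonus-mono {p} {q} sp sq lt with digits-< last {block p} {block q} sp sq lt
  ... | inj₂ (same , r<r') = +-mono-≤ (≤-reflexive (cong (3 *_) same)) (slotBonus-mono (<⇒≤ r<r'))
  ... | inj₁ b<b' = begin
    3 * block p + slotBonus (slot p) ≤⟨ +-monoʳ-≤ (3 * block p) (slotBonus-≤2 (slot p)) ⟩
    3 * block p + 2                  ≤⟨ +-monoʳ-≤ (3 * block p) (n≤1+n 2) ⟩
    3 * block p + 3                  ≡⟨ +-comm (3 * block p) 3 ⟩
    3 + 3 * block p                  ≡⟨ *-suc 3 (block p) ⟨
    3 * suc (block p)                ≤⟨ *-monoʳ-≤ 3 b<b' ⟩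
    3 * block q                      ≤⟨ m≤m+n (3 * block q) _ ⟩
    bonus q                          ∎
    where open ≤-Reasoning

  labelAt-mono : ∀ {p q} → block p ≤ block q → slot p ≤ slot q → labelAt p ≤ labelAt q
  labelAt-mono bp≤bq sp≤sq =
    +-mono-≤ (*-monoʳ-≤ (suc k) (+-mono-≤ (*-monoˡ-≤ (suc last) bp≤bq) sp≤sq))
             (+-mono-≤ (*-monoʳ-≤ 3 bp≤bq) (slotBonus-mono sp≤sq))

  labelAt-far : ∀ {p q} → slot p ≤ last → slot q ≤ last → 2 + position p ≤ position q →
                T + labelAt p ≤ suc (labelAt q)
  labelAt-far {p} {q} sp sq far = begin
    T + labelAt p                            ≡⟨ regroup k (position p) (bonus p) ⟩
    suc (suc k * (2 + position p) + bonus p) ≤⟨ s≤s (+-mono-≤ (*-monoʳ-≤ (suc k) far) bonus≤) ⟩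
    suc (labelAt q)                          ∎
    where
    open ≤-Reasoning
    bonus≤ : bonus p ≤ bonus q
    bonus≤ = bonus-mono {p} {q} sp sq (≤-trans (n≤1+n _) far)
    regroup : ∀ k P B → 1 + k * 2 + 1 + 1 + (suc k * P + B) ≡ suc (suc k * (2 + P) + B)
    regroup = solve-∀

  labelAt-step : ∀ {p q} d → suc (position p) ≡ position q → k + 2 + bonus p ≤ d + bonus q →
                 T + labelAt p ≤ d + labelAt q
  labelAt-step {p} {q} d next le = begin
    T + labelAt p                              ≡⟨ regroup k (position p) (bonus p) ⟩
    k + 2 + bonus p + suc k * suc (position p) ≤⟨ +-monoˡ-≤ _ le ⟩
    d + bonus q + suc k * suc (position p)     ≡⟨ cong (λ x → d + bonus q + suc k * x) next ⟩
    d + bonus q + suc k * position q           ≡⟨ +-assoc d (bonus q) _ ⟩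
    d + (bonus q + suc k * position q)         ≡⟨ cong (d +_) (+-comm (bonus q) _) ⟩
    d + labelAt q                              ∎
    where
    open ≤-Reasoning
    regroup : ∀ k P B → 1 + k * 2 + 1 + 1 + (suc k * P + B) ≡ k + 2 + B + suc k * suc P
    regroup = solve-∀

  same-block-bonus : ∀ {b b' r r'} s l → b' ≡ b → l ≡ k → 2 + slotBonus r ≤ s + slotBonus r' →
                     k + 2 + (3 * b + slotBonus r) ≤ s + l + (3 * b' + slotBonus r')
  same-block-bonus {b} {_} {r} {r'} s _ refl refl le = begin
    k + 2 + (3 * b + slotBonus r)  ≡⟨ regroup k (3 * b) (slotBonus r) ⟩
    2 + slotBonus r + (k + 3 * b)  ≤⟨ +-monoˡ-≤ (k + 3 * b) le ⟩
    s + slotBonus r' + (k + 3 * b) ≡⟨ regroup′ s (slotBonus r') k (3 * b) ⟩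
    s + k + (3 * b + slotBonus r') ∎
    where
    open ≤-Reasoning
    regroup : ∀ k c x → k + 2 + (c + x) ≡ 2 + x + (k + c)
    regroup = solve-∀
    regroup′ : ∀ s y k c → s + y + (k + c) ≡ s + k + (c + y)
    regroup′ = solve-∀

  next-block-bonus : ∀ {b b' r r'} d → b' ≡ suc b → suc k ≤ d →
                     k + 2 + (3 * b + slotBonus r) ≤ d + (3 * b' + slotBonus r')
  next-block-bonus {b} {_} {r} {r'} d refl 1+k≤d = begin
    k + 2 + (3 * b + slotBonus r) ≤⟨ +-monoʳ-≤ (k + 2) (+-monoʳ-≤ (3 * b) (slotBonus-≤2 r)) ⟩
    k + 2 + (3 * b + 2)           ≡⟨ regroup k b ⟩
    suc k + 3 * suc b             ≤⟨ +-mono-≤ 1+k≤d (m≤m+n (3 * suc b) (slotBonus r')) ⟩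
    d + (3 * suc b + slotBonus r') ∎
    where
    open ≤-Reasoning
    regroup : ∀ k b → k + 2 + (3 * b + 2) ≡ suc k + 3 * suc b
    regroup = solve-∀

  lower-upper-slotBonus : ∀ {t t'} s → t' ≡ t → t ≤ w → 1 ≤ s → (t ≢ 0 → t ≢ w → 2 ≤ s) →
                          2 + slotBonus (t * 2 + 0) ≤ s + slotBonus (t' * 2 + 1)
  lower-upper-slotBonus {zero} s refl _ 1≤s _ = +-monoˡ-≤ 1 1≤s
  lower-upper-slotBonus {suc t} s refl t≤w 1≤s two with suc t ≟ w
  ... | yes refl = begin
    2 + slotBonus (w * 2 + 0) ≤⟨ +-monoʳ-≤ 2 (slotBonus-<last (lower-slot-<last t≤w)) ⟩
    1 + 2                     ≤⟨ +-monoˡ-≤ 2 1≤s ⟩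
    s + 2                     ≡⟨ cong (s +_) slotBonus-last ⟨
    s + slotBonus last        ∎
    where open ≤-Reasoning
  ... | no 1+t≢w = begin
    2 + slotBonus (suc t * 2 + 0) ≤⟨ +-monoʳ-≤ 2 (slotBonus-<last (lower-slot-<last t≤w)) ⟩
    2 + 1                         ≤⟨ +-mono-≤ (two (λ ()) 1+t≢w) (s≤s z≤n) ⟩
    s + slotBonus (suc t * 2 + 1) ∎
    where open ≤-Reasoning

  upper-lower-slotBonus : ∀ {t t'} s → t' ≡ suc t → t' ≤ w → 2 ≤ s →
                          2 + slotBonus (t * 2 + 1) ≤ s + slotBonus (t' * 2 + 0)
  upper-lower-slotBonus {t} s refl t<w 2≤s = begin
    2 + slotBonus (t * 2 + 1)     ≤⟨ +-monoʳ-≤ 2 (slotBonus-<last (upper-slot-<last t<w)) ⟩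
    2 + 1                         ≤⟨ +-mono-≤ 2≤s (s≤s z≤n) ⟩
    s + slotBonus (suc t * 2 + 0) ∎
    where open ≤-Reasoning

  lower-upper-starDist : ∀ {a a' : Fin m} → upperIndex (toℕ a') ≡ toℕ a →
                         1 ≤ starDist a a' × (toℕ a ≢ 0 → toℕ a ≢ w → 2 ≤ starDist a a')
  lower-upper-starDist {a} {a'} digits =
    starDist-pos a≢a' , λ a-leaf a≢w → starDist-leaves a≢a' a-leaf (a'-leaf a≢w)
    where
    a≢a' : a ≢ a'
    a≢a' refl = upperIndex-≢ (toℕ a) digits
    a'-leaf : toℕ a ≢ w → toℕ a' ≢ 0
    a'-leaf a≢w a'-center = a≢w (trans (sym digits) (cong upperIndex a'-center))

  upper-lower-starDist : ∀ {a a' : Fin m} → toℕ a' ≡ suc (upperIndex (toℕ a)) → 2 ≤ starDist a a'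
  upper-lower-starDist {a} {a'} digits = starDist-leaves a≢a' a-leaf (1+n≢0 ∘ trans (sym digits))
    where
    a≢a' : a ≢ a'
    a≢a' refl = suc-upperIndex-≢ (toℕ a) (sym digits)
    a-leaf : toℕ a ≢ 0
    a-leaf a-center =
      1+n≰n (subst (_≤ w) (trans digits (cong (suc ∘ upperIndex) a-center)) (toℕ≤w a'))

  lower-upper-gap : ∀ {a a' i j} → i ≤ k → j ≤ k + k → k + k ∸ j ≡ k ∸ i →
                    upperIndex (toℕ a') ≡ toℕ a →
                    k + 2 + bonus (lowerPlace a i) ≤ gDist a i a' j + bonus (upperPlace a' j)
  lower-upper-gap {a} {a'} i≤k j≤2k same digits =
    same-block-bonus {r = toℕ a * 2 + 0} {upperIndex (toℕ a') * 2 + 1} (starDist a a') _ same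
      (∸≡∸⇒∣-∣ {l = k} i≤k j≤2k (sym same))
      (lower-upper-slotBonus (starDist a a') digits (toℕ≤w a) (proj₁ star) (proj₂ star))
    where
    star : 1 ≤ starDist a a' × (toℕ a ≢ 0 → toℕ a ≢ w → 2 ≤ starDist a a')
    star = lower-upper-starDist digits

  upper-lower-gap : ∀ {a a' i j} → j ≤ k → i ≤ k + k → k ∸ j ≡ k + k ∸ i →
                    toℕ a' ≡ suc (upperIndex (toℕ a)) →
                    k + 2 + bonus (upperPlace a i) ≤ gDist a i a' j + bonus (lowerPlace a' j)
  upper-lower-gap {a} {a'} {i} {j} j≤k i≤2k same digits =
    same-block-bonus {r = upperIndex (toℕ a) * 2 + 1} {toℕ a' * 2 + 0} (starDist a a') _ same
      (trans (∣-∣-comm i j) (∸≡∸⇒∣-∣ {l = k} j≤k i≤2k same))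
      (upper-lower-slotBonus (starDist a a') digits (toℕ≤w a') (upper-lower-starDist {a} digits))

  next-block-gap : ∀ {a a' i j} → j ≤ k → i ≤ k + k → k ∸ j ≡ suc (k + k ∸ i) →
                   k + 2 + bonus (upperPlace a i) ≤ gDist a i a' j + bonus (lowerPlace a' j)
  next-block-gap {a} {a'} {i} {j} j≤k i≤2k next =
    next-block-bonus {r = upperIndex (toℕ a) * 2 + 1} {toℕ a' * 2 + 0} (gDist a i a' j) next
      (≤-trans (≤-reflexive (sym distance)) (m≤n+m _ _))
    where
    distance : ∣ i - j ∣ ≡ suc k
    distance = trans (∣-∣-comm i j)
                     (∸≡∸⇒∣-∣ {l = suc k} j≤k (m≤n⇒m≤1+n i≤2k) (trans next (sym (+-∸-assoc 1 i≤2k))))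

  near-gap : ∀ {a a' i j} → InLayers n i → InLayers n j →
             suc (position (place a i)) ≡ position (place a' j) →
             T + label a i ≤ gDist a i a' j + label a' j
  near-gap {a} {a'} {i} {j} vi vj next with i ≤? k | j ≤? k
  ... | yes _ | yes _ with successor-places w (k ∸ i) (k ∸ j) (toℕ≤w a) (toℕ≤w a') z≤n z≤n next
  ...   | inj₁ (_ , _ , _ , ())
  ...   | inj₂ (inj₁ (_ , _ , () , _))
  ...   | inj₂ (inj₂ (_ , () , _))
  near-gap {a} {a'} {i} {j} vi vj next | yes i≤k | no j≰k
    with successor-places w (k ∸ i) (k + k ∸ j) (toℕ≤w a) (upperIndex-≤ (toℕ≤w a')) z≤n ≤-refl next
  ...   | inj₁ (same , digits , _ , _) =
    labelAt-step {lowerPlace a i} {upperPlace a' j} (gDist a i a' j) next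
      (lower-upper-gap {a} {a'} i≤k (proj₂ (upper-layer vj j≰k)) same digits)
  ...   | inj₂ (inj₁ (_ , _ , () , _))
  ...   | inj₂ (inj₂ (_ , () , _))
  near-gap {a} {a'} {i} {j} vi vj next | no i≰k | yes j≤k
    with successor-places w (k + k ∸ i) (k ∸ j) (upperIndex-≤ (toℕ≤w a)) (toℕ≤w a') ≤-refl z≤n next
  ...   | inj₁ (_ , _ , _ , ())
  ...   | inj₂ (inj₁ (same , digits , _ , _)) =
    labelAt-step {upperPlace a i} {lowerPlace a' j} (gDist a i a' j) next
      (upper-lower-gap {a} {a'} j≤k (proj₂ (upper-layer vi i≰k)) same digits)
  ...   | inj₂ (inj₂ (next-block , _ , _)) =
    labelAt-step {upperPlace a i} {lowerPlace a' j} (gDist a i a' j) next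
      (next-block-gap {a} {a'} j≤k (proj₂ (upper-layer vi i≰k)) next-block)
  near-gap {a} {a'} {i} {j} vi vj next | no _ | no _
    with successor-places w (k + k ∸ i) (k + k ∸ j) (upperIndex-≤ (toℕ≤w a)) (upperIndex-≤ (toℕ≤w a'))
                          ≤-refl ≤-refl next
  ...   | inj₁ (_ , _ , () , _)
  ...   | inj₂ (inj₁ (_ , _ , _ , ()))
  ...   | inj₂ (inj₂ (_ , _ , ()))

  isRadioLabeling : IsRadioLabeling m n label
  isRadioLabeling a a' i j vi vj ne =
    radio-by-order (λ u → InLayers n (proj₂ u))
      (λ u v → gDist (proj₁ u) (proj₂ u) (proj₁ v) (proj₂ v)) T
      (λ u → position (place (proj₁ u) (proj₂ u))) (λ u → label (proj₁ u) (proj₂ u))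
      (λ u v → gDist-sym (proj₁ u) (proj₂ u) (proj₁ v) (proj₂ v)) gDist-pos position-injective
      (λ {u} {v} → labelAt-far {place (proj₁ u) (proj₂ u)} {place (proj₁ v) (proj₂ v)}
                     (slot-≤-last (proj₁ u) (proj₂ u)) (slot-≤-last (proj₁ v) (proj₂ v)))
      near-gap vi vj (λ eq → ne (,-injectiveˡ eq , ,-injectiveʳ eq))

  maxLabel : ℕ
  maxLabel = labelAt ⟨ K , w , 1 ⟩

  maxLabel-closed : (m * n * n + 2 * n ∸ (2 * m * n + 3 * m + 12)) / 2 ≡ maxLabel
  maxLabel-closed = begin
    (m * n * n + 2 * n ∸ c) / 2   ≡⟨ cong (λ x → (x ∸ c) / 2) (doubled M K) ⟨
    (top * 2 + c ∸ c) / 2         ≡⟨ cong (_/ 2) (m+n∸n≡m (top * 2) c) ⟩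
    top * 2 / 2                   ≡⟨ m*n/n≡m top 2 ⟩
    top                           ≡⟨ cong (λ x → suc k * position ⟨ K , w , 1 ⟩ + (3 * K + x))
                                           slotBonus-last ⟨
    maxLabel                      ∎
    where
    open ≡-Reasoning
    c top : ℕ
    c = 2 * m * n + 3 * m + 12
    top = suc k * position ⟨ K , w , 1 ⟩ + (3 * K + 2)
    doubled : ∀ M K →
      (suc (2 + K) * (K * suc ((3 + M) * 2 + 1) + ((3 + M) * 2 + 1)) + (3 * K + 2)) * 2
        + (2 * (4 + M) * (1 + (2 + K) * 2) + 3 * (4 + M) + 12)
      ≡ (4 + M) * (1 + (2 + K) * 2) * (1 + (2 + K) * 2) + 2 * (1 + (2 + K) * 2)
    doubled = solve-∀

  spanAtMost : SpanAtMost m n label ((m * n * n + 2 * n ∸ (2 * m * n + 3 * m + 12)) / 2)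
  spanAtMost a a' i j vi _ = begin
    label a i       ≤⟨ labelAt-mono {place a i} {⟨ K , w , 1 ⟩} (block-≤ a vi) (slot-≤-last a i) ⟩
    maxLabel        ≡⟨ maxLabel-closed ⟨
    _               ≤⟨ m≤n+m _ (label a' j) ⟩
    label a' j + _  ∎
    where open ≤-Reasoning

  radioNumber : RadioNumberAtMost m n ((m * n * n + 2 * n ∸ (2 * m * n + 3 * m + 12)) / 2)
  radioNumber = label , isRadioLabeling , spanAtMost

odd≥5⇒n≡1+[2+K]*2 : ∀ {n} → 5 ≤ n → n % 2 ≡ 1 → ∃[ K ] n ≡ 1 + (2 + K) * 2
odd≥5⇒n≡1+[2+K]*2 {n} 5≤n odd = split (n / 2) n≡1+2h (subst (5 ≤_) n≡1+2h 5≤n)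
  where
  n≡1+2h : n ≡ 1 + n / 2 * 2
  n≡1+2h = trans (m≡m%n+[m/n]*n n 2) (cong (_+ n / 2 * 2) odd)
  split : ∀ h → n ≡ 1 + h * 2 → 5 ≤ 1 + h * 2 → ∃[ K ] n ≡ 1 + (2 + K) * 2
  split 0             _  (s≤s ())
  split 1             _  (s≤s (s≤s (s≤s ())))
  split (suc (suc K)) eq _ = K , eq

lemma6 : (m n : ℕ) → 4 ≤ m → 5 ≤ n → n % 2 ≡ 1 →
    RadioNumberAtMost m n ((m * n * n + 2 * n ∸ (2 * m * n + 3 * m + 12)) / 2)
lemma6 _ n (s≤s (s≤s (s≤s (s≤s (z≤n {M}))))) 5≤n odd with odd≥5⇒n≡1+[2+K]*2 5≤n odd
... | K , refl = Construction.radioNumber M K
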